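{- Let $\mathcal{L}=\{l_1, l_2, \dots, l_s\}$ be a set of $s$ nonnegative integers with $l_{1} < l_{2} < \cdots < l_{s}$. Suppose that $\mathcal{A} = \{A_1, A_2, \dots, A_{m}\}$ and $\mathcal{B} = \{B_1, B_2, \dots, B_{m}\}$ are two families of subsets of $[n]=\{1,\dots,n\}$ such that (i) $|A_{i} \cap B_{j}| \in \mathcal{L}$ for all $i \neq j$, and (ii) $A_{i} \subseteq B_{i}$ and $|A_{i}| \notin \mathcal{L}$ for every $1 \leq i \leq m$. Then \[m = |\mathcal{A}|\leq \binom{n - 1}{s} + \binom{n - 1}{s - 1} + \cdots + \binom{n - 1}{0}.\] -}

module Defs where

open import Data.Nat using (ℕ; zero; suc; _+_; _∸_; _<_)
open import Data.Nat.Combinatorics using (_C_)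
open import Data.Fin using (Fin)
open import Data.Product using (∃)
open import Relation.Binary.PropositionalEquality using (_≡_)

binomSum : ℕ → ℕ → ℕ
binomSum N zero    = N C 0
binomSum N (suc k) = N C (suc k) + binomSum N k

-- the set L = {l_1 < ... < l_s} given as a strictly increasing map Fin s → ℕ
StrictlyIncreasing : {s : ℕ} → (Fin s → ℕ) → Set
StrictlyIncreasing {s} l = ∀ (i j : Fin s) → Data.Fin._<_ i j → l i < l j

InL : {s : ℕ} → (Fin s → ℕ) → ℕ → Set
InL l x = ∃ λ k → l k ≡ x

{-# OPTIONS --safe #-}
-- Write f j (Y) = ∏ₖ (|A j ∩ Y| − l k). Then f j (B i) = 0 for j ≠ i, while f i (B i) ≠ 0
-- since |A i ∩ B i| = |A i| ∉ L. Substituting 1 for the first coordinate and reducing with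
-- x² = x turns f j into a multilinear polynomial H j of degree ≤ s in the remaining n − 1
-- variables, H j (Y) = f j (Y ∪ {0}); such polynomials span a space of dimension
-- Σ_{k ≤ s} C(n − 1, k). The H j are linearly independent: evaluate a relation
-- Σ α j H j = 0 at B i ∖ {0}. If 0 ∈ B i, this isolates α i. Otherwise 0 ∉ A i as well, and
-- each term j ≠ i vanishes, either because 0 ∉ A j, so that f j (B i ∪ {0}) = f j (B i) = 0,
-- or because 0 ∈ A j ⊆ B j and hence α j = 0 by the first case.
module Submission where

open import Defs
open import Data.Nat using (ℕ; _≤_; _∸_)
open import Data.Fin using (Fin)
open import Data.Fin.Subset using (Subset; _∩_; _⊆_; ∣_∣)
open import Relation.Binary.PropositionalEquality using (_≡_)
open import Relation.Nullary using (¬_)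

open import Data.Bool using (Bool; true; false; _∧_)
open import Data.Empty using (⊥-elim)
open import Data.Fin using (zero; suc; splitAt; _↑ˡ_; _↑ʳ_; punchIn; punchOut)
import Data.Fin.Properties as Finₚ
open import Data.Fin.Subset using (inside; outside; _∈_; _∉_)
open import Data.Fin.Subset.Properties using (_∈?_; ⊆-antisym; p∩q⊆p; x∈p∩q⁺)
open import Data.Integer using (ℤ; +_; 0ℤ; 1ℤ; _+_; _*_; _-_; -_)
import Data.Integer.Properties as ℤₚ
open import Data.Integer.Tactic.RingSolver using (solve-∀)
open import Data.Nat as ℕ using (suc; zero; _<_)
import Data.Nat.Properties as ℕₚ
import Data.Nat.Tactic.RingSolver as ℕ-Solver
open import Data.Nat.Combinatorics using (_C_; nCk+nC[k+1]≡[n+1]C[k+1])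
open import Data.Product.Base using (Σ; ∃-syntax; _×_; _,_; proj₁; proj₂)
open import Data.Sum using (_⊎_; inj₁; inj₂; [_,_]′)
open import Data.Vec using ([]; _∷_; tail; here)
open import Data.Vec.Functional using (Vector)
open import Function using (_∘_)
open import Relation.Binary.PropositionalEquality
  using (refl; sym; trans; cong; cong₂; subst; _≢_; module ≡-Reasoning)
open import Relation.Nullary using (yes; no; contradiction)

open import Algebra.Properties.Semiring.Sum ℤₚ.+-*-semiring
  using (sum; sum-syntax; sum-cong-≗; sum-replicate-zero; sum-remove; ∑-distrib-+; *-distribˡ-sum)
open import Algebra.Properties.Monoid.Sum ℤₚ.*-1-monoid
  using () renaming (sum to product; sum-cong-≗ to product-cong-≗)

open ≡-Reasoning

sum-zero : ∀ {M} {f : Vector ℤ M} → (∀ j → f j ≡ 0ℤ) → sum f ≡ 0ℤ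
sum-zero {M} f≡0 = trans (sum-cong-≗ f≡0) (sum-replicate-zero M)

sum-single : ∀ {M} (f : Vector ℤ M) i → (∀ j → j ≢ i → f j ≡ 0ℤ) → sum f ≡ f i
sum-single {suc M} f i others≡0 = begin
  sum f                     ≡⟨ sum-remove {i = i} f ⟩
  f i + sum (f ∘ punchIn i) ≡⟨ cong (_+_ (f i)) (sum-zero (λ j → others≡0 _ (Finₚ.punchInᵢ≢i i j))) ⟩
  f i + 0ℤ                  ≡⟨ ℤₚ.+-identityʳ (f i) ⟩
  f i                       ∎

product-zero : ∀ {s} (f : Vector ℤ s) k → f k ≡ 0ℤ → product f ≡ 0ℤ
product-zero f zero    fk≡0 = cong (_* product (f ∘ suc)) fk≡0
product-zero f (suc k) fk≡0 = trans (cong (f zero *_) (product-zero (f ∘ suc) k fk≡0)) (ℤₚ.*-zeroʳ (f zero))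

product-nonzero : ∀ {s} (f : Vector ℤ s) → (∀ k → f k ≢ 0ℤ) → product f ≢ 0ℤ
product-nonzero {zero}  f _      ()
product-nonzero {suc s} f f≢0 ∏≡0 with ℤₚ.i*j≡0⇒i≡0∨j≡0 (f zero) ∏≡0
... | inj₁ f₀≡0 = f≢0 zero f₀≡0
... | inj₂ ∏≡0′ = product-nonzero (f ∘ suc) (f≢0 ∘ suc) ∏≡0′

IsRelation : ∀ {M} {I : Set} → Vector ℤ M → (Fin M → I → ℤ) → Set
IsRelation {M} α v = ∀ d → ∑[ j < M ] (α j * v j d) ≡ 0ℤ

LinearlyDependent : ∀ {M} {I : Set} → (Fin M → I → ℤ) → Set
LinearlyDependent {M} v = Σ (Vector ℤ M) λ α → (∃[ j ] α j ≢ 0ℤ) × IsRelation α v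

LinearlyIndependent : ∀ {M} {I : Set} → (Fin M → I → ℤ) → Set
LinearlyIndependent {M} v = ∀ (α : Vector ℤ M) → IsRelation α v → ∀ j → α j ≡ 0ℤ

relation-isolates : ∀ {M} (α c : Vector ℤ M) i → ∑[ j < M ] (α j * c j) ≡ 0ℤ →
  (∀ j → j ≢ i → α j * c j ≡ 0ℤ) → c i ≢ 0ℤ → α i ≡ 0ℤ
relation-isolates α c i relation others≡0 cᵢ≢0
  with ℤₚ.i*j≡0⇒i≡0∨j≡0 (α i) (trans (sym (sum-single (λ j → α j * c j) i others≡0)) relation)
... | inj₁ αᵢ≡0 = αᵢ≡0
... | inj₂ cᵢ≡0 = contradiction cᵢ≡0 cᵢ≢0

v₀≡0⇒linearlyDependent : ∀ {M D} (v : Fin (suc M) → Vector ℤ D) → (∀ d → v zero d ≡ 0ℤ) →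
  LinearlyDependent v
v₀≡0⇒linearlyDependent {M} v v₀≡0 = α , (zero , λ ()) , relation
  where
  α : Vector ℤ (suc M)
  α zero    = 1ℤ
  α (suc _) = 0ℤ
  relation : IsRelation α v
  relation d rewrite v₀≡0 d = trans (ℤₚ.+-identityˡ _) (sum-replicate-zero M)

relation-punchIn⁻ : ∀ {M D} (β : Vector ℤ M) (u : Fin M → Vector ℤ (suc D)) d₀ → (∀ k → u k d₀ ≡ 0ℤ) →
  IsRelation β (λ k → u k ∘ punchIn d₀) → IsRelation β u
relation-punchIn⁻ {M} β u d₀ u≡0 relation d with d Finₚ.≟ d₀
... | yes refl = sum-zero (λ k → trans (cong (β k *_) (u≡0 k)) (ℤₚ.*-zeroʳ (β k)))
... | no d≢d₀  = subst (λ e → ∑[ k < M ] (β k * u k e) ≡ 0ℤ)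
                       (Finₚ.punchIn-punchOut (d≢d₀ ∘ sym))
                       (relation (punchOut (d≢d₀ ∘ sym)))

-- One step of Gaussian elimination with pivot v zero d₀.
rowReduce : ∀ {M D} → (Fin (suc M) → Vector ℤ D) → Fin D → Fin M → Vector ℤ D
rowReduce v d₀ k d = v zero d₀ * v (suc k) d - v (suc k) d₀ * v zero d

rowReduce-pivot : ∀ {M D} (v : Fin (suc M) → Vector ℤ D) d₀ k → rowReduce v d₀ k d₀ ≡ 0ℤ
rowReduce-pivot v d₀ k = ℤₚ.i≡j⇒i-j≡0 (ℤₚ.*-comm (v zero d₀) (v (suc k) d₀))

linearlyDependent-rowReduce⁻ : ∀ {M D} (v : Fin (suc M) → Vector ℤ D) d₀ → v zero d₀ ≢ 0ℤ →
  LinearlyDependent (rowReduce v d₀) → LinearlyDependent v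
linearlyDependent-rowReduce⁻ {M} v d₀ pivot≢0 (β , (k₀ , βₖ₀≢0) , β-relation) =
  α , (suc k₀ , αₖ₀≢0) , α-relation
  where
  pivot : ℤ
  pivot = v zero d₀

  α : Vector ℤ (suc M)
  α zero    = - (∑[ k < M ] (β k * v (suc k) d₀))
  α (suc k) = pivot * β k

  αₖ₀≢0 : pivot * β k₀ ≢ 0ℤ
  αₖ₀≢0 eq with ℤₚ.i*j≡0⇒i≡0∨j≡0 pivot eq
  ... | inj₁ pivot≡0 = pivot≢0 pivot≡0
  ... | inj₂ βₖ₀≡0   = βₖ₀≢0 βₖ₀≡0

  α-relation : IsRelation α v
  α-relation d = begin
    α zero * v zero d + sum a                   ≡⟨ swap (sum b) (v zero d) (sum a) ⟩
    sum a + (- v zero d) * sum b                ≡⟨ cong (_+_ (sum a)) (*-distribˡ-sum (- v zero d) b) ⟩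
    sum a + ∑[ k < M ] ((- v zero d) * b k)     ≡⟨ sym (∑-distrib-+ a (λ k → (- v zero d) * b k)) ⟩
    ∑[ k < M ] (a k + (- v zero d) * b k)       ≡⟨ sum-cong-≗ (λ k → expand pivot (β k) _ (v zero d) _) ⟩
    ∑[ k < M ] (β k * rowReduce v d₀ k d)       ≡⟨ β-relation d ⟩
    0ℤ                                          ∎
    where
    a b : Vector ℤ M
    a k = pivot * β k * v (suc k) d
    b k = β k * v (suc k) d₀
    swap : ∀ S x T → (- S) * x + T ≡ T + (- x) * S
    swap = solve-∀
    expand : ∀ p b x x₀ y → p * b * x + (- x₀) * (b * y) ≡ b * (p * x - y * x₀)
    expand = solve-∀

D<M⇒linearlyDependent : ∀ {M D} → D < M → (v : Fin M → Vector ℤ D) → LinearlyDependent v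
D<M⇒linearlyDependent {suc M} {zero}  _           v = v₀≡0⇒linearlyDependent v (λ ())
D<M⇒linearlyDependent {suc M} {suc D} (ℕ.s≤s D<M) v with Finₚ.all? (λ d → v zero d ℤₚ.≟ 0ℤ)
... | yes v₀≡0 = v₀≡0⇒linearlyDependent v v₀≡0
... | no  v₀≢0 with Finₚ.¬∀⟶∃¬ (suc D) _ (λ d → v zero d ℤₚ.≟ 0ℤ) v₀≢0
...   | d₀ , pivot≢0 with D<M⇒linearlyDependent D<M (λ k → rowReduce v d₀ k ∘ punchIn d₀)
...     | β , β≢0 , relation = linearlyDependent-rowReduce⁻ v d₀ pivot≢0
  (β , β≢0 , relation-punchIn⁻ β (rowReduce v d₀) d₀ (rowReduce-pivot v d₀) relation)

-- Poly n k: multilinear polynomials of degree ≤ k in n variables; in n + 1 variables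
-- the pair (p , q) stands for p + x₀ q.
Poly : ℕ → ℕ → Set
Poly n       zero    = ℤ
Poly zero    (suc k) = ℤ
Poly (suc n) (suc k) = Poly n (suc k) × Poly n k

𝟙 : Bool → ℤ
𝟙 true  = 1ℤ
𝟙 false = 0ℤ

eval : ∀ {n k} → Poly n k → Subset n → ℤ
eval {n}     {zero}  c       _       = c
eval {zero}  {suc k} c       _       = c
eval {suc n} {suc k} (p , q) (x ∷ y) = eval p y + 𝟙 x * eval q y

const : ∀ {n k} → ℤ → Poly n k
const {n}     {zero}  c = c
const {zero}  {suc k} c = c
const {suc n} {suc k} c = const c , const 0ℤ

eval-const : ∀ {n k} c (y : Subset n) → eval (const {n} {k} c) y ≡ c
eval-const {n}     {zero}  c y       = refl
eval-const {zero}  {suc k} c y       = refl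
eval-const {suc n} {suc k} c (x ∷ y) rewrite eval-const {k = suc k} c y | eval-const {k = k} 0ℤ y =
  trans (cong (_+_ c) (ℤₚ.*-zeroʳ (𝟙 x))) (ℤₚ.+-identityʳ c)

infixl 6 _⊕_
infixl 7 _⊙_

_⊕_ : ∀ {n k} → Poly n k → Poly n k → Poly n k
_⊕_ {n}     {zero}  c       c′        = c + c′
_⊕_ {zero}  {suc k} c       c′        = c + c′
_⊕_ {suc n} {suc k} (p , q) (p′ , q′) = p ⊕ p′ , q ⊕ q′

eval-⊕ : ∀ {n k} (p p′ : Poly n k) y → eval (p ⊕ p′) y ≡ eval p y + eval p′ y
eval-⊕ {n}     {zero}  c       c′        y       = refl
eval-⊕ {zero}  {suc k} c       c′        y       = refl
eval-⊕ {suc n} {suc k} (p , q) (p′ , q′) (x ∷ y)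
  rewrite eval-⊕ p p′ y | eval-⊕ q q′ y = distrib (eval p y) (eval q y) (eval p′ y) (eval q′ y) (𝟙 x)
  where
  distrib : ∀ a b a′ b′ t → (a + a′) + t * (b + b′) ≡ (a + t * b) + (a′ + t * b′)
  distrib = solve-∀

_⊙_ : ∀ {n k} → ℤ → Poly n k → Poly n k
_⊙_ {n}     {zero}  c p       = c * p
_⊙_ {zero}  {suc k} c p       = c * p
_⊙_ {suc n} {suc k} c (p , q) = c ⊙ p , c ⊙ q

eval-⊙ : ∀ {n k} c (p : Poly n k) y → eval (c ⊙ p) y ≡ c * eval p y
eval-⊙ {n}     {zero}  c p       y       = refl
eval-⊙ {zero}  {suc k} c p       y       = refl
eval-⊙ {suc n} {suc k} c (p , q) (x ∷ y)
  rewrite eval-⊙ c p y | eval-⊙ c q y = distrib c (eval p y) (eval q y) (𝟙 x)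
  where
  distrib : ∀ c a b t → c * a + t * (c * b) ≡ c * (a + t * b)
  distrib = solve-∀

raise : ∀ {n k} → Poly n k → Poly n (suc k)
raise {n}     {zero}  c       = const c
raise {zero}  {suc k} c       = c
raise {suc n} {suc k} (p , q) = raise p , raise q

eval-raise : ∀ {n k} (p : Poly n k) y → eval (raise p) y ≡ eval p y
eval-raise {n}     {zero}  c       y       = eval-const {k = 1} c y
eval-raise {zero}  {suc k} c       y       = refl
eval-raise {suc n} {suc k} (p , q) (x ∷ y) rewrite eval-raise p y | eval-raise q y = refl

-- Multiplication by an affine form ℓ, reduced modulo x² = x.
_⊛_ : ∀ {n k} → Poly n k → Poly n 1 → Poly n (suc k)
_⊛_ {n}     {zero}  c       ℓ       = c ⊙ ℓ
_⊛_ {zero}  {suc k} c       ℓ       = c * ℓ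
_⊛_ {suc n} {suc k} (p , q) (ℓ , b) = p ⊛ ℓ , q ⊛ ℓ ⊕ b ⊙ (p ⊕ raise q)

eval-⊛ : ∀ {n k} (p : Poly n k) ℓ y → eval (p ⊛ ℓ) y ≡ eval p y * eval ℓ y
eval-⊛ {n}     {zero}  c       ℓ       y       = eval-⊙ c ℓ y
eval-⊛ {zero}  {suc k} c       ℓ       y       = refl
eval-⊛ {suc n} {suc k} (p , q) (ℓ , b) (x ∷ y)
  rewrite eval-⊛ p ℓ y | eval-⊕ (q ⊛ ℓ) (b ⊙ (p ⊕ raise q)) y | eval-⊛ q ℓ y
        | eval-⊙ b (p ⊕ raise q) y | eval-⊕ p (raise q) y | eval-raise q y
  = expand x (eval p y) (eval q y) (eval ℓ y) b
  where
  -- both cases hold because 𝟙 x * 𝟙 x ≡ 𝟙 x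
  expand : ∀ x a c l b → a * l + 𝟙 x * (c * l + b * (a + c)) ≡ (a + 𝟙 x * c) * (l + 𝟙 x * b)
  expand true  = solve-∀
  expand false = solve-∀

𝟙-∧ : ∀ a x → 𝟙 (a ∧ x) ≡ 𝟙 a * 𝟙 x
𝟙-∧ true  true  = refl
𝟙-∧ true  false = refl
𝟙-∧ false _     = refl

∣∷∣ : ∀ {n} x (p : Subset n) → + ∣ x ∷ p ∣ ≡ 𝟙 x + + ∣ p ∣
∣∷∣ true  p = refl
∣∷∣ false p = refl

affine : ∀ {n} → Subset n → ℤ → Poly n 1
affine []      c = c
affine (b ∷ a) c = affine a c , 𝟙 b

eval-affine : ∀ {n} (a : Subset n) c y → eval (affine a c) y ≡ + ∣ a ∩ y ∣ + c
eval-affine []      c []      = sym (ℤₚ.+-identityˡ c)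
eval-affine (b ∷ a) c (x ∷ y) rewrite eval-affine a c y | ∣∷∣ (b ∧ x) (a ∩ y) | 𝟙-∧ b x =
  shuffle (+ ∣ a ∩ y ∣) c (𝟙 x) (𝟙 b)
  where
  shuffle : ∀ l c x a → l + c + x * a ≡ a * x + l + c
  shuffle = solve-∀

∏ : ∀ {n s} → Vector (Poly n 1) s → Poly n s
∏ {s = zero}  ℓ = 1ℤ
∏ {s = suc s} ℓ = ∏ (ℓ ∘ suc) ⊛ ℓ zero

eval-∏ : ∀ {n s} (ℓ : Vector (Poly n 1) s) y → eval (∏ ℓ) y ≡ product (λ k → eval (ℓ k) y)
eval-∏ {s = zero}  ℓ y = refl
eval-∏ {s = suc s} ℓ y rewrite eval-⊛ (∏ (ℓ ∘ suc)) (ℓ zero) y | eval-∏ (ℓ ∘ suc) y =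
  ℤₚ.*-comm _ (eval (ℓ zero) y)

specialiseFirst : ∀ {n k} → Poly (suc n) k → Poly n k
specialiseFirst {k = zero}  c       = c
specialiseFirst {k = suc k} (p , q) = p ⊕ raise q

eval-specialiseFirst : ∀ {n k} (p : Poly (suc n) k) y → eval (specialiseFirst p) y ≡ eval p (inside ∷ y)
eval-specialiseFirst {k = zero}  c       y = refl
eval-specialiseFirst {k = suc k} (p , q) y rewrite eval-⊕ p (raise q) y | eval-raise q y =
  cong (_+_ (eval p y)) (sym (ℤₚ.*-identityˡ (eval q y)))

dim : ℕ → ℕ → ℕ
dim n       zero    = 1
dim zero    (suc k) = 1
dim (suc n) (suc k) = dim n (suc k) ℕ.+ dim n k

coeffs : ∀ {n k} → Poly n k → Vector ℤ (dim n k)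
coeffs {n}     {zero}  c       _ = c
coeffs {zero}  {suc k} c       _ = c
coeffs {suc n} {suc k} (p , q) i = [ coeffs p , coeffs q ]′ (splitAt (dim n (suc k)) i)

binomSum-zero : ∀ k → binomSum 0 k ≡ 1
binomSum-zero zero    = refl
binomSum-zero (suc k) = binomSum-zero k

binomSum-pascal : ∀ n k → binomSum (suc n) (suc k) ≡ binomSum n (suc k) ℕ.+ binomSum n k
binomSum-pascal n zero =
  trans (cong (ℕ._+ 1) (sym (nCk+nC[k+1]≡[n+1]C[k+1] n 0))) (ℕₚ.+-comm 1 (n C 1 ℕ.+ 1))
binomSum-pascal n (suc k) = begin
  suc n C suc (suc k) ℕ.+ binomSum (suc n) (suc k)
    ≡⟨ cong₂ ℕ._+_ (sym (nCk+nC[k+1]≡[n+1]C[k+1] n (suc k))) (binomSum-pascal n k) ⟩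
  (n C suc k ℕ.+ n C suc (suc k)) ℕ.+ (binomSum n (suc k) ℕ.+ binomSum n k)
    ≡⟨ regroup (n C suc k) (n C suc (suc k)) (binomSum n (suc k)) (binomSum n k) ⟩
  (n C suc (suc k) ℕ.+ binomSum n (suc k)) ℕ.+ (n C suc k ℕ.+ binomSum n k)
    ∎
  where
  regroup : ∀ a b c d → (a ℕ.+ b) ℕ.+ (c ℕ.+ d) ≡ (b ℕ.+ c) ℕ.+ (a ℕ.+ d)
  regroup = ℕ-Solver.solve-∀

dim≡binomSum : ∀ n k → dim n k ≡ binomSum n k
dim≡binomSum n       zero    = refl
dim≡binomSum zero    (suc k) = sym (binomSum-zero k)
dim≡binomSum (suc n) (suc k) =
  trans (cong₂ ℕ._+_ (dim≡binomSum n (suc k)) (dim≡binomSum n k)) (sym (binomSum-pascal n k))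

coeffs-↑ˡ : ∀ {n k} (p : Poly n (suc k)) (q : Poly n k) d →
  coeffs {suc n} {suc k} (p , q) (d ↑ˡ dim n k) ≡ coeffs p d
coeffs-↑ˡ {n} {k} p q d = cong [ coeffs p , coeffs q ]′ (Finₚ.splitAt-↑ˡ (dim n (suc k)) d (dim n k))

coeffs-↑ʳ : ∀ {n k} (p : Poly n (suc k)) (q : Poly n k) d →
  coeffs {suc n} {suc k} (p , q) (dim n (suc k) ↑ʳ d) ≡ coeffs q d
coeffs-↑ʳ {n} {k} p q d = cong [ coeffs p , coeffs q ]′ (Finₚ.splitAt-↑ʳ (dim n (suc k)) (dim n k) d)

coeffs-relation⇒eval-relation : ∀ {n k M} (α : Vector ℤ M) (P : Fin M → Poly n k) →
  IsRelation α (λ j → coeffs (P j)) → IsRelation α (λ j → eval (P j))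
coeffs-relation⇒eval-relation {n}     {zero}      α P relation y       = relation zero
coeffs-relation⇒eval-relation {zero}  {suc k}     α P relation y       = relation zero
coeffs-relation⇒eval-relation {suc n} {suc k} {M} α P relation (x ∷ y) = begin
  ∑[ j < M ] (α j * (eval (p j) y + 𝟙 x * eval (q j) y))
    ≡⟨ sum-cong-≗ (λ j → distrib (α j) (eval (p j) y) (𝟙 x) (eval (q j) y)) ⟩
  ∑[ j < M ] (e₀ j + 𝟙 x * e₁ j)
    ≡⟨ ∑-distrib-+ e₀ (λ j → 𝟙 x * e₁ j) ⟩
  sum e₀ + ∑[ j < M ] (𝟙 x * e₁ j)
    ≡⟨ cong (_+_ (sum e₀)) (*-distribˡ-sum (𝟙 x) e₁) ⟨
  sum e₀ + 𝟙 x * sum e₁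
    ≡⟨ cong₂ (λ a b → a + 𝟙 x * b) e₀-relation e₁-relation ⟩
  0ℤ + 𝟙 x * 0ℤ
    ≡⟨ trans (ℤₚ.+-identityˡ _) (ℤₚ.*-zeroʳ (𝟙 x)) ⟩
  0ℤ
    ∎
  where
  p : Fin M → Poly n (suc k)
  p = proj₁ ∘ P
  q : Fin M → Poly n k
  q = proj₂ ∘ P
  e₀ e₁ : Vector ℤ M
  e₀ j = α j * eval (p j) y
  e₁ j = α j * eval (q j) y
  distrib : ∀ a e t f → a * (e + t * f) ≡ a * e + t * (a * f)
  distrib = solve-∀
  p-relation : IsRelation α (λ j → coeffs (p j))
  p-relation d = trans (sum-cong-≗ (λ j → cong (α j *_) (sym (coeffs-↑ˡ (p j) (q j) d))))
                       (relation (d ↑ˡ dim n k))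
  q-relation : IsRelation α (λ j → coeffs (q j))
  q-relation d = trans (sum-cong-≗ (λ j → cong (α j *_) (sym (coeffs-↑ʳ (p j) (q j) d))))
                       (relation (dim n (suc k) ↑ʳ d))
  e₀-relation : sum e₀ ≡ 0ℤ
  e₀-relation = coeffs-relation⇒eval-relation α p p-relation y
  e₁-relation : sum e₁ ≡ 0ℤ
  e₁-relation = coeffs-relation⇒eval-relation α q q-relation y

linearlyIndependent⇒≤binomSum : ∀ {n k m} (P : Fin m → Poly n k) →
  LinearlyIndependent (λ j → eval (P j)) → m ≤ binomSum n k
linearlyIndependent⇒≤binomSum {n} {k} {m} P independent with m ℕₚ.≤? binomSum n k
... | yes m≤ = m≤
... | no  m≰
  with D<M⇒linearlyDependent (subst (_< m) (sym (dim≡binomSum n k)) (ℕₚ.≰⇒> m≰)) (λ j → coeffs (P j))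
...   | α , (j , αⱼ≢0) , relation =
  contradiction (independent α (coeffs-relation⇒eval-relation α P relation) j) αⱼ≢0

p⊆q⇒p∩q≡p : ∀ {n} {p q : Subset n} → p ⊆ q → p ∩ q ≡ p
p⊆q⇒p∩q≡p {p = p} {q} p⊆q = ⊆-antisym (p∩q⊆p p q) (λ x∈p → x∈p∩q⁺ (x∈p , p⊆q x∈p))

∩-inside∷tail : ∀ {n} (p q : Subset (suc n)) → zero ∈ q ⊎ zero ∉ p → p ∩ (inside ∷ tail q) ≡ p ∩ q
∩-inside∷tail p             (inside  ∷ q) _          = refl
∩-inside∷tail (outside ∷ p) (outside ∷ q) _          = refl
∩-inside∷tail (inside  ∷ p) (outside ∷ q) (inj₁ ())
∩-inside∷tail (inside  ∷ p) (outside ∷ q) (inj₂ 0∉p) = contradiction here 0∉p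

module CrossIntersecting {n s m : ℕ} (l : Fin s → ℕ) (A B : Fin m → Subset (suc n))
  (cross : ∀ (i j : Fin m) → i ≢ j → InL l ∣ A i ∩ B j ∣)
  (A⊆B : ∀ (i : Fin m) → A i ⊆ B i)
  (diagonal : ∀ (i : Fin m) → ¬ InL l ∣ A i ∣) where

  f : Fin m → Subset (suc n) → ℤ
  f j Y = product (λ k → + ∣ A j ∩ Y ∣ - + l k)

  f-off-diagonal : ∀ {i j} → j ≢ i → f j (B i) ≡ 0ℤ
  f-off-diagonal {i} {j} j≢i with cross j i j≢i
  ... | k , lₖ≡ = product-zero _ k (ℤₚ.i≡j⇒i-j≡0 (cong +_ (sym lₖ≡)))

  f-diagonal : ∀ i → f i (B i) ≢ 0ℤ
  f-diagonal i = product-nonzero _ λ k fᵢₖ≡0 →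
    diagonal i (k , trans (sym (ℤₚ.+-injective (ℤₚ.i-j≡0⇒i≡j _ _ fᵢₖ≡0)))
                          (cong ∣_∣ (p⊆q⇒p∩q≡p (A⊆B i))))

  f-inside∷tail : ∀ {i j} → zero ∈ B i ⊎ zero ∉ A j → f j (inside ∷ tail (B i)) ≡ f j (B i)
  f-inside∷tail {i} {j} side =
    cong (λ Y → product (λ k → + ∣ Y ∣ - + l k)) (∩-inside∷tail (A j) (B i) side)

  0∈B⊎0∉A : ∀ i → zero ∈ B i ⊎ zero ∉ A i
  0∈B⊎0∉A i with zero ∈? B i
  ... | yes 0∈Bᵢ = inj₁ 0∈Bᵢ
  ... | no  0∉Bᵢ = inj₂ (0∉Bᵢ ∘ A⊆B i)

  F : Fin m → Poly (suc n) s
  F j = ∏ (λ k → affine (A j) (- + l k))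

  eval-F : ∀ j Y → eval (F j) Y ≡ f j Y
  eval-F j Y = trans (eval-∏ (λ k → affine (A j) (- + l k)) Y)
                     (product-cong-≗ {s} (λ k → eval-affine (A j) _ Y))

  H : Fin m → Poly n s
  H j = specialiseFirst (F j)

  eval-H : ∀ j y → eval (H j) y ≡ f j (inside ∷ y)
  eval-H j y = trans (eval-specialiseFirst (F j) y) (eval-F j (inside ∷ y))

  H-independent : LinearlyIndependent (λ j → eval (H j))
  H-independent α relation = α-vanishes
    where
    c : Fin m → Vector ℤ m
    c i j = f j (inside ∷ tail (B i))

    isolated : ∀ i → (∀ j → j ≢ i → α j * c i j ≡ 0ℤ) → α i ≡ 0ℤ
    isolated i others≡0 = relation-isolates α (c i) i
      (trans (sum-cong-≗ (λ j → cong (α j *_) (sym (eval-H j _)))) (relation (tail (B i))))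
      others≡0
      (λ cᵢᵢ≡0 → f-diagonal i (trans (sym (f-inside∷tail (0∈B⊎0∉A i))) cᵢᵢ≡0))

    off-diagonal : ∀ {i j} → j ≢ i → zero ∈ B i ⊎ zero ∉ A j → α j * c i j ≡ 0ℤ
    off-diagonal {i} {j} j≢i side =
      trans (cong (α j *_) (trans (f-inside∷tail side) (f-off-diagonal j≢i))) (ℤₚ.*-zeroʳ (α j))

    α-vanishes-if-0∈B : ∀ i → zero ∈ B i → α i ≡ 0ℤ
    α-vanishes-if-0∈B i 0∈Bᵢ = isolated i (λ j j≢i → off-diagonal j≢i (inj₁ 0∈Bᵢ))

    α-vanishes : ∀ i → α i ≡ 0ℤ
    α-vanishes i with zero ∈? B i
    ... | yes 0∈Bᵢ = α-vanishes-if-0∈B i 0∈Bᵢ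
    ... | no  _    = isolated i others≡0
      where
      others≡0 : ∀ j → j ≢ i → α j * c i j ≡ 0ℤ
      others≡0 j j≢i with zero ∈? A j
      ... | yes 0∈Aⱼ = cong (_* c i j) (α-vanishes-if-0∈B j (A⊆B j 0∈Aⱼ))
      ... | no  0∉Aⱼ = off-diagonal j≢i (inj₂ 0∉Aⱼ)

  m≤binomSum : m ≤ binomSum n s
  m≤binomSum = linearlyIndependent⇒≤binomSum H H-independent

∩-empty : (p q : Subset 0) → p ∩ q ≡ p
∩-empty [] [] = refl

lemma2p7 : (n s m : ℕ) (l : Fin s → ℕ) → StrictlyIncreasing l →
    (A B : Fin m → Subset n) →
    (∀ (i j : Fin m) → ¬ (i ≡ j) → InL l ∣ A i ∩ B j ∣) →
    (∀ (i : Fin m) → A i ⊆ B i) →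
    (∀ (i : Fin m) → ¬ InL l ∣ A i ∣) →
    m ≤ binomSum (n ∸ 1) s
lemma2p7 (suc n) s m             l _ A B cross A⊆B diagonal =
  CrossIntersecting.m≤binomSum l A B cross A⊆B diagonal
lemma2p7 zero    s zero          l _ A B _     _   _        = ℕ.z≤n
lemma2p7 zero    s (suc zero)    l _ A B _     _   _        = ℕₚ.≤-reflexive (sym (binomSum-zero s))
lemma2p7 zero    s (suc (suc m)) l _ A B cross _   diagonal =
  ⊥-elim (diagonal zero (subst (InL l ∘ ∣_∣) (∩-empty (A zero) (B (suc zero)))
                               (cross zero (suc zero) (λ ()))))
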